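{- Let $a$ and $b$ be relatively prime positive integers and let $k \ge 0$ be an integer. Let $T_k(a,b)$ be the set of all nonnegative integers $j$ having at most $k$ representations $j = ma+nb$ with $(m,n) \in \mathbb{Z}_{\ge 0}^2$. Let $g_{\le k}(a,b)$ be the largest element of $T_k(a,b)$, $c_{\le k}(a,b)$ its cardinality, and $s_{\le k}(a,b)$ the sum of its elements. Then \begin{itemize} \item $g_{ \le k } (a, b) = (k+1)ab - a - b$; \item $c_{ \le k } (a, b) = \tfrac 1 2 (a-1)(b-1) + abk$; \item $s_{ \le k } (a, b) = \tfrac{ 1 }{ 2 } \, a^2 b^2 k^2 + \tfrac{ 1 }{ 2 } \left( ab - a - b \right) abk + \tfrac 1 6 \, a^2 b^2 - \tfrac 1 4 \left( a+b-1 \right) ab + \tfrac{ 1 }{ 12 } \left( a^2 + b^2 - 1 \right)$. \end{itemize}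
   Context: The number of representations of $j$ is the number of pairs $(m,n) \in \mathbb{Z}_{\ge 0}^2$ with $ma+nb=j$. -}

module Defs where

open import Data.Nat using (ℕ; suc; _+_; _*_; _≟_)
open import Data.Product using (_×_; _,_; proj₁; proj₂)
open import Data.List using (List; length; filter; cartesianProduct; upTo)
open import Relation.Binary.PropositionalEquality using (_≡_)

-- All pairs (m , n) ∈ ℕ² with m ≤ j and n ≤ j.  For positive a, b every
-- representation j = m*a + n*b has m ≤ j and n ≤ j, so this is a complete
-- search space.
candidates : ℕ → List (ℕ × ℕ)
candidates j = cartesianProduct (upTo (suc j)) (upTo (suc j))

representations : ℕ → ℕ → ℕ → List (ℕ × ℕ)
representations a b j =
  filter (λ p → (proj₁ p * a + proj₂ p * b) ≟ j) (candidates j)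

numReps : ℕ → ℕ → ℕ → ℕ
numReps a b j = length (representations a b j)

module Submission where

-- For j ∈ ℕ let μ j be the unique m < b with m·a ≡ j (mod b).  The
-- multiplier of a in any representation of j is μ j + s·b for some s ≥ 0, and
-- the admissible s are exactly those with (μ j + s·b)·a ≤ j.  Hence
--     numReps j ≤ k  ⇔  j < (μ j + k·b)·a                      (numReps≤⇔)
-- which gives the bound j + a + b ≤ (k + 1)·a·b, attained when μ j = b - 1.
-- Grouped by residue class modulo b, T_k(a, b) is the disjoint union over
-- m < b of the progressions with difference b that start at m·a mod b and stop
-- below (m + k·b)·a.  Length and sum are computed block by block in ℤ:
-- b·|block| = end - start and 2·b·Σ block = Φ end - Φ start with
-- Φ x = x·(x - b); as the starts run through 0, …, b - 1, only sums of
-- polynomials over 0, …, b - 1 remain, which have closed forms.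

open import Defs
open import Data.Nat using (ℕ; _+_; _*_; _∸_; _≤_; _<_)
open import Data.Nat.Coprimality using (Coprime)
open import Data.Integer using (ℤ; +_; _-_) renaming (_+_ to _+ℤ_; _*_ to _*ℤ_; _≤_ to _≤ℤ_)
open import Data.List using (List; length)
open import Data.Nat.ListAction using (sum)
open import Data.List.Membership.Propositional using (_∈_)
open import Data.List.Relation.Unary.Unique.Propositional using (Unique)
open import Data.Product using (_×_; Σ)
open import Function.Bundles using (_⇔_)
open import Relation.Binary.PropositionalEquality using (_≡_)

open import Data.Nat using (zero; suc; pred; _%_; _/_; NonZero; >-nonZero⁻¹)
open import Data.Integer using (0ℤ)
open import Data.List using ([]; _∷_; _++_; [_]; map; upTo; foldr; concatMap)
open import Data.List.Membership.Propositional using (find)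
open import Data.List.Relation.Binary.Permutation.Propositional using (_↭_)
import Data.List.Relation.Unary.Unique.Propositional.Properties as Unique
open import Data.Product using (_,_; proj₁; proj₂)
open import Function.Bundles using (mk⇔; Equivalence)
open import Relation.Binary.PropositionalEquality
  using (refl; sym; trans; cong; cong₂; subst; subst₂; module ≡-Reasoning)

module ListFacts where
  open import Data.Empty using (⊥)
  open import Data.List.Properties using (length-++)
  open import Data.List.Membership.Propositional.Properties using (∈-concatMap⁻)
  open import Data.List.Membership.Propositional.Properties.WithK using (unique∧set⇒bag)
  open import Data.List.Relation.Binary.BagAndSetEquality using (∼bag⇒↭)
  import Data.List.Relation.Unary.All as All
  open import Data.List.Relation.Unary.AllPairs using ([]; _∷_)
  open import Data.List.Relation.Unary.Any using (here; there)
  open import Data.Nat.ListAction.Properties using (sum-++)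

  same-members⇒↭ : {A : Set} {xs ys : List A} → Unique xs → Unique ys →
    (∀ {x} → x ∈ xs → x ∈ ys) → (∀ {x} → x ∈ ys → x ∈ xs) → xs ↭ ys
  same-members⇒↭ xs! ys! to from = ∼bag⇒↭ (unique∧set⇒bag xs! ys! (mk⇔ to from))

  concatMap-unique : {A B : Set} (L : A → List B) {ms : List A} → Unique ms →
    (∀ m → Unique (L m)) →
    (∀ {m m' x} → m ∈ ms → m' ∈ ms → x ∈ L m → x ∈ L m' → m ≡ m') →
    Unique (concatMap L ms)
  concatMap-unique L [] L! disjoint = []
  concatMap-unique L {m ∷ ms} (m∉ms ∷ ms!) L! disjoint =
    Unique.++⁺ (L! m) (concatMap-unique L ms! L! (λ p p' → disjoint (there p) (there p'))) apart
    where
    apart : ∀ {x} → x ∈ L m × x ∈ concatMap L ms → ⊥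
    apart (x∈Lm , x∈rest) with find (∈-concatMap⁻ L {xs = ms} x∈rest)
    ... | m' , m'∈ms , x∈Lm' = All.lookup m∉ms m'∈ms (disjoint (here refl) (there m'∈ms) x∈Lm x∈Lm')

  length-concatMap : {A B : Set} (L : A → List B) (ms : List A) →
    length (concatMap L ms) ≡ sum (map (λ m → length (L m)) ms)
  length-concatMap L [] = refl
  length-concatMap L (m ∷ ms) = trans (length-++ (L m)) (cong (λ n → length (L m) + n) (length-concatMap L ms))

  sum-concatMap : {A : Set} (L : A → List ℕ) (ms : List A) →
    sum (concatMap L ms) ≡ sum (map (λ m → sum (L m)) ms)
  sum-concatMap L [] = refl
  sum-concatMap L (m ∷ ms) = trans (sum-++ (L m) _) (cong (λ n → sum (L m) + n) (sum-concatMap L ms))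

module IntegerSums where
  open import Algebra.Bundles using (CommutativeMonoid)
  open import Data.Integer.Properties
    using (+-0-commutativeMonoid; +-assoc; +-identityˡ; +-identityʳ; *-zeroʳ; *-distribˡ-+)
  import Data.Integer.Tactic.RingSolver as ℤ-Solver
  open import Data.List.Properties using (map-cong; upTo-∷ʳ)
  open import Data.List.Relation.Binary.Permutation.Propositional using (↭⇒↭ₛ)
  import Data.List.Relation.Binary.Permutation.Propositional.Properties as ↭
  open import Data.List.Relation.Binary.Permutation.Setoid.Properties using (foldr-commMonoid)

  ∑ : List ℕ → (ℕ → ℤ) → ℤ
  ∑ xs f = foldr _+ℤ_ 0ℤ (map f xs)

  ∑-cong : ∀ xs {f g : ℕ → ℤ} → (∀ x → f x ≡ g x) → ∑ xs f ≡ ∑ xs g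
  ∑-cong xs f≗g = cong (foldr _+ℤ_ 0ℤ) (map-cong f≗g xs)

  ∑-++ : ∀ xs ys (f : ℕ → ℤ) → ∑ (xs ++ ys) f ≡ ∑ xs f +ℤ ∑ ys f
  ∑-++ [] ys f = sym (+-identityˡ _)
  ∑-++ (x ∷ xs) ys f = trans (cong (f x +ℤ_) (∑-++ xs ys f)) (sym (+-assoc (f x) _ _))

  ∑-upTo-suc : ∀ n (f : ℕ → ℤ) → ∑ (upTo (suc n)) f ≡ ∑ (upTo n) f +ℤ f n
  ∑-upTo-suc n f = begin
    ∑ (upTo (suc n)) f          ≡⟨ cong (λ xs → ∑ xs f) (sym (upTo-∷ʳ n)) ⟩
    ∑ (upTo n ++ [ n ]) f       ≡⟨ ∑-++ (upTo n) [ n ] f ⟩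
    ∑ (upTo n) f +ℤ (f n +ℤ 0ℤ) ≡⟨ cong (∑ (upTo n) f +ℤ_) (+-identityʳ (f n)) ⟩
    ∑ (upTo n) f +ℤ f n         ∎
    where open ≡-Reasoning

  ∑-- : ∀ xs (f g : ℕ → ℤ) → ∑ xs (λ x → f x - g x) ≡ ∑ xs f - ∑ xs g
  ∑-- [] f g = refl
  ∑-- (x ∷ xs) f g = trans (cong (f x - g x +ℤ_) (∑-- xs f g)) (regroup (f x) (g x) (∑ xs f) (∑ xs g))
    where
    regroup : ∀ u v s t → u - v +ℤ (s - t) ≡ u +ℤ s - (v +ℤ t)
    regroup = ℤ-Solver.solve-∀

  ∑-*ˡ : ∀ xs c (f : ℕ → ℤ) → ∑ xs (λ x → c *ℤ f x) ≡ c *ℤ ∑ xs f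
  ∑-*ˡ [] c f = sym (*-zeroʳ c)
  ∑-*ˡ (x ∷ xs) c f = trans (cong (c *ℤ f x +ℤ_) (∑-*ˡ xs c f)) (sym (*-distribˡ-+ c (f x) _))

  ∑-↭ : ∀ {xs ys} (f : ℕ → ℤ) → xs ↭ ys → ∑ xs f ≡ ∑ ys f
  ∑-↭ f p = foldr-commMonoid setoid isCommutativeMonoid (↭⇒↭ₛ (↭.map⁺ f p))
    where open CommutativeMonoid +-0-commutativeMonoid using (setoid; isCommutativeMonoid)

  sum-cast : ∀ xs (f : ℕ → ℕ) → + sum (map f xs) ≡ ∑ xs (λ x → + f x)
  sum-cast [] f = refl
  sum-cast (x ∷ xs) f = cong (+ f x +ℤ_) (sum-cast xs f)

  ∑-telescope : ∀ c (f F : ℕ → ℤ) → F 0 ≡ 0ℤ → (∀ i → c *ℤ f i ≡ F (suc i) - F i) →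
    ∀ n → c *ℤ ∑ (upTo n) f ≡ F n
  ∑-telescope c f F F0≡0 step zero = trans (*-zeroʳ c) (sym F0≡0)
  ∑-telescope c f F F0≡0 step (suc n) = begin
    c *ℤ ∑ (upTo (suc n)) f          ≡⟨ cong (c *ℤ_) (∑-upTo-suc n f) ⟩
    c *ℤ (∑ (upTo n) f +ℤ f n)       ≡⟨ *-distribˡ-+ c (∑ (upTo n) f) (f n) ⟩
    c *ℤ ∑ (upTo n) f +ℤ c *ℤ f n    ≡⟨ cong₂ _+ℤ_ (∑-telescope c f F F0≡0 step n) (step n) ⟩
    F n +ℤ (F (suc n) - F n)         ≡⟨ cancel (F n) (F (suc n)) ⟩
    F (suc n)                        ∎
    where
    open ≡-Reasoning
    cancel : ∀ x y → x +ℤ (y - x) ≡ y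
    cancel = ℤ-Solver.solve-∀

  ∑-linear : ∀ n q s → let N = + n in
    + 2 *ℤ ∑ (upTo n) (λ i → q *ℤ + i +ℤ s) ≡ q *ℤ (N *ℤ N - N) +ℤ + 2 *ℤ s *ℤ N
  ∑-linear n q s =
    ∑-telescope (+ 2) (λ i → q *ℤ + i +ℤ s) (λ i → closed q s (+ i)) (start q s) (λ i → step q s (+ i)) n
    where
    closed : ℤ → ℤ → ℤ → ℤ
    closed q s N = q *ℤ (N *ℤ N - N) +ℤ + 2 *ℤ s *ℤ N
    start : ∀ q s → q *ℤ (+ 0 *ℤ + 0 - + 0) +ℤ + 2 *ℤ s *ℤ + 0 ≡ 0ℤ
    start = ℤ-Solver.solve-∀
    step : ∀ q s N → + 2 *ℤ (q *ℤ N +ℤ s)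
      ≡ q *ℤ ((+ 1 +ℤ N) *ℤ (+ 1 +ℤ N) - (+ 1 +ℤ N)) +ℤ + 2 *ℤ s *ℤ (+ 1 +ℤ N)
        - (q *ℤ (N *ℤ N - N) +ℤ + 2 *ℤ s *ℤ N)
    step = ℤ-Solver.solve-∀

  ∑-quadratic : ∀ n p q s → let N = + n in
    + 6 *ℤ ∑ (upTo n) (λ i → p *ℤ (+ i *ℤ + i) +ℤ q *ℤ + i +ℤ s)
      ≡ p *ℤ (+ 2 *ℤ N *ℤ N *ℤ N - + 3 *ℤ N *ℤ N +ℤ N) +ℤ + 3 *ℤ q *ℤ (N *ℤ N - N) +ℤ + 6 *ℤ s *ℤ N
  ∑-quadratic n p q s =
    ∑-telescope (+ 6) (λ i → p *ℤ (+ i *ℤ + i) +ℤ q *ℤ + i +ℤ s) (λ i → closed p q s (+ i))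
      (start p q s) (λ i → step p q s (+ i)) n
    where
    closed : ℤ → ℤ → ℤ → ℤ → ℤ
    closed p q s N = p *ℤ (+ 2 *ℤ N *ℤ N *ℤ N - + 3 *ℤ N *ℤ N +ℤ N) +ℤ + 3 *ℤ q *ℤ (N *ℤ N - N) +ℤ + 6 *ℤ s *ℤ N
    start : ∀ p q s → p *ℤ (+ 2 *ℤ + 0 *ℤ + 0 *ℤ + 0 - + 3 *ℤ + 0 *ℤ + 0 +ℤ + 0)
                        +ℤ + 3 *ℤ q *ℤ (+ 0 *ℤ + 0 - + 0) +ℤ + 6 *ℤ s *ℤ + 0 ≡ 0ℤ
    start = ℤ-Solver.solve-∀
    step : ∀ p q s N → + 6 *ℤ (p *ℤ (N *ℤ N) +ℤ q *ℤ N +ℤ s)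
      ≡ p *ℤ (+ 2 *ℤ (+ 1 +ℤ N) *ℤ (+ 1 +ℤ N) *ℤ (+ 1 +ℤ N) - + 3 *ℤ (+ 1 +ℤ N) *ℤ (+ 1 +ℤ N) +ℤ (+ 1 +ℤ N))
          +ℤ + 3 *ℤ q *ℤ ((+ 1 +ℤ N) *ℤ (+ 1 +ℤ N) - (+ 1 +ℤ N)) +ℤ + 6 *ℤ s *ℤ (+ 1 +ℤ N)
        - (p *ℤ (+ 2 *ℤ N *ℤ N *ℤ N - + 3 *ℤ N *ℤ N +ℤ N) +ℤ + 3 *ℤ q *ℤ (N *ℤ N - N) +ℤ + 6 *ℤ s *ℤ N)
    step = ℤ-Solver.solve-∀

  -- Φ d x = x·(x - d) satisfies Φ d (x + d) - Φ d x = 2·d·x, so 2·d·(sum of an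
  -- arithmetic progression with difference d) = Φ d (end) - Φ d (start).
  Φ : ℤ → ℤ → ℤ
  Φ d x = x *ℤ (x - d)

  ∑-progression : ∀ c r d →
    + 2 *ℤ d *ℤ ∑ (upTo c) (λ i → r +ℤ + i *ℤ d) ≡ Φ d (r +ℤ + c *ℤ d) - Φ d r
  ∑-progression c r d =
    ∑-telescope (+ 2 *ℤ d) (λ i → r +ℤ + i *ℤ d) (λ i → Φ d (r +ℤ + i *ℤ d) - Φ d r)
      (start r d) (λ i → step r d (+ i)) c
    where
    start : ∀ r d → (r +ℤ + 0 *ℤ d) *ℤ ((r +ℤ + 0 *ℤ d) - d) - r *ℤ (r - d) ≡ 0ℤ
    start = ℤ-Solver.solve-∀
    step : ∀ r d C → + 2 *ℤ d *ℤ (r +ℤ C *ℤ d)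
      ≡ (r +ℤ (+ 1 +ℤ C) *ℤ d) *ℤ ((r +ℤ (+ 1 +ℤ C) *ℤ d) - d) - r *ℤ (r - d)
        - ((r +ℤ C *ℤ d) *ℤ ((r +ℤ C *ℤ d) - d) - r *ℤ (r - d))
    step = ℤ-Solver.solve-∀

module Residues (a b : ℕ) .{{_ : NonZero b}} (coprime : Coprime a b) where
  open import Data.Nat using (>-nonZero)
  open import Data.Nat.Properties
  open import Data.Nat.DivMod
  open import Data.Nat.Divisibility using (_∣_; divides; n∣m*n; ∣m+n∣m⇒∣n; >⇒∤; ∣⇒≤)
  open import Data.Nat.Coprimality using (coprime-Bézout; coprime-divisor) renaming (sym to coprime-sym)
  open import Data.Nat.GCD using (module Bézout)
  import Data.Nat.Tactic.RingSolver as ℕ-Solver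
  open import Data.Sum using (inj₁; inj₂)
  open import Relation.Nullary using (contradiction)
  open ≡-Reasoning

  %-cong-* : ∀ {u v} w → u % b ≡ v % b → (u * w) % b ≡ (v * w) % b
  %-cong-* {u} {v} w eq = begin
    (u * w) % b               ≡⟨ %-distribˡ-* u w b ⟩
    (u % b * (w % b)) % b     ≡⟨ cong (λ z → (z * (w % b)) % b) eq ⟩
    (v % b * (w % b)) % b     ≡⟨ sym (%-distribˡ-* v w b) ⟩
    (v * w) % b               ∎

  same-residue⇒∣ : ∀ x y → (x + y) % b ≡ x % b → b ∣ y
  same-residue⇒∣ x y eq = ∣m+n∣m⇒∣n (divides ((x + y) / b) shifted) (n∣m*n (x / b))
    where
    shifted : x / b * b + y ≡ (x + y) / b * b
    shifted = +-cancelˡ-≡ (x % b) _ _ (begin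
      x % b + (x / b * b + y)       ≡⟨ sym (+-assoc (x % b) _ y) ⟩
      x % b + x / b * b + y         ≡⟨ cong (_+ y) (sym (m≡m%n+[m/n]*n x b)) ⟩
      x + y                         ≡⟨ m≡m%n+[m/n]*n (x + y) b ⟩
      (x + y) % b + (x + y) / b * b ≡⟨ cong (_+ (x + y) / b * b) eq ⟩
      x % b + (x + y) / b * b       ∎)

  small-multiple : ∀ {d} → d < b → b ∣ d → d ≡ 0
  small-multiple {zero}  _   _   = refl
  small-multiple {suc d} d<b b∣d = contradiction b∣d (>⇒∤ d<b)

  residue-gap : ∀ {x y} → x < y → x % b ≡ y % b → x + b ≤ y
  residue-gap {x} {y} x<y eq = subst (x + b ≤_) (m+[n∸m]≡n (<⇒≤ x<y)) (+-monoʳ-≤ x (∣⇒≤ {{d≢0}} b∣d))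
    where
    d = y ∸ x
    b∣d : b ∣ d
    b∣d = same-residue⇒∣ x d (trans (cong (_% b) (m+[n∸m]≡n (<⇒≤ x<y))) (sym eq))
    d≢0 : NonZero d
    d≢0 = >-nonZero (m<n⇒0<n∸m x<y)

  multiplier-shift : ∀ m k → (m + k * b) * a ≡ m * a + k * a * b
  multiplier-shift m k = expand m k a b
    where
    expand : ∀ m k a b → (m + k * b) * a ≡ m * a + k * a * b
    expand = ℕ-Solver.solve-∀

  multiplier-period : ∀ m k → ((m + k * b) * a) % b ≡ (m * a) % b
  multiplier-period m k = trans (cong (_% b) (multiplier-shift m k)) ([m+kn]%n≡m%n (m * a) (k * a) b)

  multiples-injective-≤ : ∀ {m m'} → m ≤ m' → m' < b → (m * a) % b ≡ (m' * a) % b → m ≡ m'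
  multiples-injective-≤ {m} {m'} m≤m' m'<b eq = begin
    m            ≡⟨ sym (+-identityʳ m) ⟩
    m + 0        ≡⟨ cong (λ n → m + n) (sym d≡0) ⟩
    m + (m' ∸ m) ≡⟨ m+[n∸m]≡n m≤m' ⟩
    m'           ∎
    where
    d = m' ∸ m
    same : (m * a + d * a) % b ≡ (m * a) % b
    same = begin
      (m * a + d * a) % b ≡⟨ cong (_% b) (sym (*-distribʳ-+ a m d)) ⟩
      ((m + d) * a) % b   ≡⟨ cong (λ z → (z * a) % b) (m+[n∸m]≡n m≤m') ⟩
      (m' * a) % b        ≡⟨ sym eq ⟩
      (m * a) % b         ∎
    b∣a*d : b ∣ a * d
    b∣a*d = subst (b ∣_) (*-comm d a) (same-residue⇒∣ (m * a) (d * a) same)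
    d≡0 : d ≡ 0
    d≡0 = small-multiple (≤-<-trans (m∸n≤m m' m) m'<b) (coprime-divisor (coprime-sym coprime) b∣a*d)

  multiples-injective : ∀ {m m'} → m < b → m' < b → (m * a) % b ≡ (m' * a) % b → m ≡ m'
  multiples-injective {m} {m'} m<b m'<b eq with ≤-total m m'
  ... | inj₁ m≤m' = multiples-injective-≤ m≤m' m'<b eq
  ... | inj₂ m'≤m = sym (multiples-injective-≤ m'≤m m<b (sym eq))

  -- a is invertible modulo b, by a Bézout identity for gcd(a, b) = 1.  Only
  -- this defining property is used, so the witness is kept opaque.
  opaque
    inverse : Σ ℕ λ x → (x * a) % b ≡ 1 % b
    inverse with coprime-Bézout coprime
    ... | Bézout.+- x y eq = x , (begin
      (x * a) % b     ≡⟨ cong (_% b) (sym eq) ⟩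
      (1 + y * b) % b ≡⟨ [m+kn]%n≡m%n 1 y b ⟩
      1 % b           ∎)
    ... | Bézout.-+ x y eq = pred b * x , (begin
      (pred b * x * a) % b     ≡⟨ sym ([m+n]%n≡m%n (pred b * x * a) b) ⟩
      (pred b * x * a + b) % b ≡⟨ cong (_% b) lifted ⟩
      (1 + pred b * y * b) % b ≡⟨ [m+kn]%n≡m%n 1 (pred b * y) b ⟩
      1 % b                    ∎)
      where
      regroup : ∀ p x a → p * x * a + suc p ≡ 1 + p * (1 + x * a)
      regroup = ℕ-Solver.solve-∀
      lifted : pred b * x * a + b ≡ 1 + pred b * y * b
      lifted = begin
        pred b * x * a + b            ≡⟨ cong (λ n → pred b * x * a + n) (sym (suc-pred b)) ⟩
        pred b * x * a + suc (pred b) ≡⟨ regroup (pred b) x a ⟩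
        1 + pred b * (1 + x * a)      ≡⟨ cong (λ z → 1 + pred b * z) eq ⟩
        1 + pred b * (y * b)          ≡⟨ cong suc (sym (*-assoc (pred b) y b)) ⟩
        1 + pred b * y * b            ∎

  -- μ j is the unique m < b with m·a ≡ j (mod b), namely j·a⁻¹ mod b.
  μ : ℕ → ℕ
  μ j = (j * proj₁ inverse) % b

  μ<b : ∀ j → μ j < b
  μ<b j = m%n<n (j * proj₁ inverse) b

  μ-residue : ∀ j → (μ j * a) % b ≡ j % b
  μ-residue j = begin
    ((j * x) % b * a) % b ≡⟨ %-cong-* a (m%n%n≡m%n (j * x) b) ⟩
    (j * x * a) % b       ≡⟨ cong (_% b) (trans (*-assoc j x a) (*-comm j (x * a))) ⟩
    (x * a * j) % b       ≡⟨ %-cong-* j (proj₂ inverse) ⟩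
    (1 * j) % b           ≡⟨ cong (_% b) (*-identityˡ j) ⟩
    j % b                 ∎
    where x = proj₁ inverse

  μ-unique : ∀ {j m} → m < b → (m * a) % b ≡ j % b → m ≡ μ j
  μ-unique {j} m<b eq = multiples-injective m<b (μ<b j) (trans eq (sym (μ-residue j)))

module Representations (a b : ℕ) .{{_ : NonZero a}} .{{_ : NonZero b}} (coprime : Coprime a b) where
  open Residues a b coprime
  open ListFacts using (same-members⇒↭)
  open import Data.Nat using (_≟_; _≤?_; z≤n; s≤s)
  open import Data.Nat.Properties
  open import Data.Nat.DivMod
  open import Data.Nat.Divisibility using (_∣_)
  import Data.Nat.Tactic.RingSolver as ℕ-Solver
  open import Data.List.Properties using (length-map; length-upTo)
  open import Data.List.Relation.Binary.Permutation.Propositional.Properties using (↭-length)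
  open import Data.List.Membership.Propositional.Properties
    using (∈-filter⁺; ∈-filter⁻; ∈-cartesianProduct⁺; ∈-upTo⁺; ∈-upTo⁻; ∈-map⁺; ∈-map⁻)
  open import Data.Empty using (⊥-elim)
  open import Data.List.Relation.Unary.AllPairs using ([])
  open import Relation.Nullary using (yes; no)
  open import Algebra.Properties.CommutativeSemigroup +-commutativeSemigroup using (xy∙z≈xz∙y)

  ∈-representations⁺ : ∀ {j m n} → m * a + n * b ≡ j → (m , n) ∈ representations a b j
  ∈-representations⁺ {j} {m} {n} eq =
    ∈-filter⁺ (λ p → (proj₁ p * a + proj₂ p * b) ≟ j)
      (∈-cartesianProduct⁺ (∈-upTo⁺ (s≤s m≤j)) (∈-upTo⁺ (s≤s n≤j))) eq
    where
    m≤j : m ≤ j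
    m≤j = subst (m ≤_) eq (≤-trans (m≤m*n m a) (m≤m+n (m * a) (n * b)))
    n≤j : n ≤ j
    n≤j = subst (n ≤_) eq (≤-trans (m≤m*n n b) (m≤n+m (n * b) (m * a)))

  ∈-representations⁻ : ∀ {j m n} → (m , n) ∈ representations a b j → m * a + n * b ≡ j
  ∈-representations⁻ {j} p = proj₂ (∈-filter⁻ (λ p → (proj₁ p * a + proj₂ p * b) ≟ j) {xs = candidates j} p)

  representations-unique : ∀ j → Unique (representations a b j)
  representations-unique j =
    Unique.filter⁺ (λ p → (proj₁ p * a + proj₂ p * b) ≟ j)
      (Unique.cartesianProduct⁺ (Unique.upTo⁺ (suc j)) (Unique.upTo⁺ (suc j)))

  multiplier-form : ∀ {j m n} → m * a + n * b ≡ j → m ≡ μ j + (m / b) * b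
  multiplier-form {j} {m} {n} eq = begin
    m                   ≡⟨ m≡m%n+[m/n]*n m b ⟩
    m % b + m / b * b   ≡⟨ cong (_+ m / b * b) (μ-unique (m%n<n m b) residue) ⟩
    μ j + m / b * b     ∎
    where
    open ≡-Reasoning
    residue : (m % b * a) % b ≡ j % b
    residue = begin
      (m % b * a) % b     ≡⟨ %-cong-* a (m%n%n≡m%n m b) ⟩
      (m * a) % b         ≡⟨ sym ([m+kn]%n≡m%n (m * a) n b) ⟩
      (m * a + n * b) % b ≡⟨ cong (_% b) eq ⟩
      j % b               ∎

  shift : ∀ μ s n → (μ + s * b) * a + n * b ≡ μ * a + (s * a + n) * b
  shift μ s n = lemma μ s n a b
    where
    lemma : ∀ μ s n a b → (μ + s * b) * a + n * b ≡ μ * a + (s * a + n) * b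
    lemma = ℕ-Solver.solve-∀

  candidate : ℕ → ℕ → ℕ → ℕ × ℕ
  candidate j q s = (μ j + s * b , q ∸ s * a)

  candidate-solves : ∀ {j q s} → μ j * a + q * b ≡ j → s ≤ q / a →
    proj₁ (candidate j q s) * a + proj₂ (candidate j q s) * b ≡ j
  candidate-solves {j} {q} {s} eq s≤q/a = begin
    (μ j + s * b) * a + (q ∸ s * a) * b ≡⟨ shift (μ j) s (q ∸ s * a) ⟩
    μ j * a + (s * a + (q ∸ s * a)) * b ≡⟨ cong (λ z → μ j * a + z * b) (m+[n∸m]≡n sa≤q) ⟩
    μ j * a + q * b                     ≡⟨ eq ⟩
    j                                   ∎
    where
    open ≡-Reasoning
    sa≤q : s * a ≤ q
    sa≤q = ≤-trans (*-monoˡ-≤ a s≤q/a) (m/n*n≤m q a)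

  solution⇒candidate : ∀ {j q m n} → μ j * a + q * b ≡ j → m * a + n * b ≡ j →
    Σ ℕ λ s → s ≤ q / a × (m , n) ≡ candidate j q s
  solution⇒candidate {j} {q} {m} {n} eq solution = s , s≤q/a , cong₂ _,_ m≡ n≡
    where
    open ≡-Reasoning
    s = m / b
    m≡ : m ≡ μ j + s * b
    m≡ = multiplier-form {n = n} solution
    sa+n≡q : s * a + n ≡ q
    sa+n≡q = *-cancelʳ-≡ _ _ b (+-cancelˡ-≡ (μ j * a) _ _ (begin
      μ j * a + (s * a + n) * b ≡⟨ sym (shift (μ j) s n) ⟩
      (μ j + s * b) * a + n * b ≡⟨ cong (λ z → z * a + n * b) (sym m≡) ⟩
      m * a + n * b             ≡⟨ solution ⟩
      j                         ≡⟨ sym eq ⟩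
      μ j * a + q * b           ∎))
    s≤q/a : s ≤ q / a
    s≤q/a = subst (_≤ q / a) (m*n/n≡m s a) (/-monoˡ-≤ a (subst (s * a ≤_) sa+n≡q (m≤m+n (s * a) n)))
    n≡ : n ≡ q ∸ s * a
    n≡ = sym (trans (cong (_∸ s * a) (sym sa+n≡q)) (m+n∸m≡n (s * a) n))

  numReps-count : ∀ {j q} → μ j * a + q * b ≡ j → numReps a b j ≡ suc (q / a)
  numReps-count {j} {q} eq = begin
    numReps a b j               ≡⟨ ↭-length (same-members⇒↭ (representations-unique j) family-unique to from) ⟩
    length family           ≡⟨ length-map (candidate j q) (upTo (suc (q / a))) ⟩
    length (upTo (suc (q / a))) ≡⟨ length-upTo (suc (q / a)) ⟩
    suc (q / a)                 ∎
    where
    open ≡-Reasoning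
    family : List (ℕ × ℕ)
    family = map (candidate j q) (upTo (suc (q / a)))
    family-unique : Unique family
    family-unique = Unique.map⁺ (λ e → *-cancelʳ-≡ _ _ b (+-cancelˡ-≡ (μ j) _ _ (cong proj₁ e))) (Unique.upTo⁺ _)
    from : ∀ {x} → x ∈ family → x ∈ representations a b j
    from x∈ with ∈-map⁻ (candidate j q) {xs = upTo (suc (q / a))} x∈
    ... | s , s∈ , refl = ∈-representations⁺ (candidate-solves {q = q} eq (≤-pred (∈-upTo⁻ s∈)))
    to : ∀ {x} → x ∈ representations a b j → x ∈ family
    to {m , n} x∈ with solution⇒candidate {q = q} {m} {n} eq (∈-representations⁻ x∈)
    ... | s , s≤q/a , refl = ∈-map⁺ (candidate j q) (∈-upTo⁺ (s≤s s≤q/a))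

  numReps-zero : ∀ {j} → j < μ j * a → numReps a b j ≡ 0
  numReps-zero {j} j<μa = ↭-length (same-members⇒↭ (representations-unique j) [] none λ ())
    where
    none : ∀ {x} → x ∈ representations a b j → x ∈ []
    none {m , n} x∈ = ⊥-elim (<⇒≱ j<μa (begin
      μ j * a       ≤⟨ *-monoˡ-≤ a μ≤m ⟩
      m * a         ≤⟨ m≤m+n (m * a) (n * b) ⟩
      m * a + n * b ≡⟨ solution ⟩
      j             ∎))
      where
      open ≤-Reasoning
      solution : m * a + n * b ≡ j
      solution = ∈-representations⁻ x∈
      μ≤m : μ j ≤ m
      μ≤m = subst (μ j ≤_) (sym (multiplier-form {n = n} solution)) (m≤m+n (μ j) _)

  quotient<⇔ : ∀ q k → q / a < k ⇔ q < k * a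
  quotient<⇔ q k = mk⇔ bound m<n*o⇒m/o<n
    where
    bound : q / a < k → q < k * a
    bound q/a<k = begin-strict
      q                 ≡⟨ m≡m%n+[m/n]*n q a ⟩
      q % a + q / a * a <⟨ +-monoˡ-< (q / a * a) (m%n<n q a) ⟩
      suc (q / a) * a   ≤⟨ *-monoˡ-≤ a q/a<k ⟩
      k * a             ∎
      where open ≤-Reasoning

  -- The counting criterion: j has at most k representations exactly when
  -- j < (μ j + k·b)·a, i.e. when the (k+1)-st candidate multiplier
  -- μ j + k·b of a already overshoots j.
  numReps≤⇔ : ∀ j k → numReps a b j ≤ k ⇔ j < (μ j + k * b) * a
  numReps≤⇔ j k with μ j * a ≤? j
  ... | no μa≰j = mk⇔ (λ _ → <-≤-trans j<μa (*-monoˡ-≤ a (m≤m+n (μ j) (k * b))))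
                      (λ _ → subst (_≤ k) (sym (numReps-zero j<μa)) z≤n)
    where
    j<μa : j < μ j * a
    j<μa = ≰⇒> μa≰j
  ... | yes μa≤j = mk⇔ fwd bwd
    where
    d = j ∸ μ j * a
    q = d / b
    b∣d : b ∣ d
    b∣d = same-residue⇒∣ (μ j * a) d (trans (cong (_% b) (m+[n∸m]≡n μa≤j)) (sym (μ-residue j)))
    decomposition : μ j * a + q * b ≡ j
    decomposition = trans (cong (λ z → μ j * a + z) (m/n*n≡m b∣d)) (m+[n∸m]≡n μa≤j)
    count : numReps a b j ≡ suc (q / a)
    count = numReps-count decomposition
    threshold : (μ j + k * b) * a ≡ μ j * a + k * a * b
    threshold = multiplier-shift (μ j) k
    fwd : numReps a b j ≤ k → j < (μ j + k * b) * a
    fwd few = subst₂ _<_ decomposition (sym threshold)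
      (+-monoʳ-< (μ j * a) (*-monoˡ-< b (Equivalence.to (quotient<⇔ q k) (subst (_≤ k) count few))))
    bwd : j < (μ j + k * b) * a → numReps a b j ≤ k
    bwd below = subst (_≤ k) (sym count) (Equivalence.from (quotient<⇔ q k)
      (*-cancelʳ-< b q (k * a) (+-cancelˡ-< (μ j * a) _ _ (subst₂ _<_ (sym decomposition) threshold below))))

  few-representations⇒bounded : ∀ j k → numReps a b j ≤ k → j + a + b ≤ (k + 1) * a * b
  few-representations⇒bounded j k few = begin
    j + a + b                ≡⟨ xy∙z≈xz∙y j a b ⟩
    j + b + a                ≤⟨ +-monoˡ-≤ a (residue-gap below same-class) ⟩
    (μ j + k * b) * a + a    ≡⟨ regroup (μ j) k a b ⟩
    (suc (μ j) + k * b) * a  ≤⟨ *-monoˡ-≤ a (+-monoˡ-≤ (k * b) (μ<b j)) ⟩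
    (b + k * b) * a          ≡⟨ rearrange k a b ⟩
    (k + 1) * a * b          ∎
    where
    open ≤-Reasoning
    below : j < (μ j + k * b) * a
    below = Equivalence.to (numReps≤⇔ j k) few
    same-class : j % b ≡ ((μ j + k * b) * a) % b
    same-class = sym (trans (multiplier-period (μ j) k) (μ-residue j))
    regroup : ∀ μ k a b → (μ + k * b) * a + a ≡ (suc μ + k * b) * a
    regroup = ℕ-Solver.solve-∀
    rearrange : ∀ k a b → (b + k * b) * a ≡ (k + 1) * a * b
    rearrange = ℕ-Solver.solve-∀

  bound-attained : ∀ g k → g + a + b ≡ (k + 1) * a * b → numReps a b g ≤ k
  bound-attained g k eq = Equivalence.from (numReps≤⇔ g k) (begin-strict
    g                       <⟨ m<m+n g (>-nonZero⁻¹ b) ⟩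
    g + b                   ≡⟨ g+b≡ ⟩
    (pred b + k * b) * a    ≡⟨ cong (λ m → (m + k * b) * a) μg≡ ⟩
    (μ g + k * b) * a       ∎)
    where
    open ≤-Reasoning
    g+b≡ : g + b ≡ (pred b + k * b) * a
    g+b≡ = +-cancelʳ-≡ a _ _ (begin-equality
      g + b + a               ≡⟨ xy∙z≈xz∙y g b a ⟩
      g + a + b               ≡⟨ eq ⟩
      (k + 1) * a * b         ≡⟨ cong (λ n → (k + 1) * a * n) (sym (suc-pred b)) ⟩
      (k + 1) * a * suc (pred b)          ≡⟨ rearrange k a (pred b) ⟩
      (pred b + k * suc (pred b)) * a + a ≡⟨ cong (λ n → (pred b + k * n) * a + a) (suc-pred b) ⟩
      (pred b + k * b) * a + a            ∎)
      where
      rearrange : ∀ k a p → (k + 1) * a * suc p ≡ (p + k * suc p) * a + a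
      rearrange = ℕ-Solver.solve-∀
    pred-b<b : pred b < b
    pred-b<b = ≤-reflexive (suc-pred b)
    μg≡ : pred b ≡ μ g
    μg≡ = μ-unique pred-b<b (begin-equality
      (pred b * a) % b              ≡⟨ sym (multiplier-period (pred b) k) ⟩
      ((pred b + k * b) * a) % b    ≡⟨ cong (_% b) (sym g+b≡) ⟩
      (g + b) % b                   ≡⟨ [m+n]%n≡m%n g b ⟩
      g % b                         ∎)

module Casts where
  open import Data.Integer using (-_; +≤+)
  open import Data.Integer.Properties using (pos-*; m-n≡m⊖n; ⊖-≥; +-monoˡ-≤; +-injective)
  import Data.Integer.Tactic.RingSolver as ℤ-Solver

  infixl 6 _⊕_
  infixl 7 _⊗_

  data Expr : Set where
    ‵_      : ℕ → Expr
    _⊕_ _⊗_ : Expr → Expr → Expr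

  ⟦_⟧ℕ : Expr → ℕ
  ⟦ ‵ n ⟧ℕ   = n
  ⟦ e ⊕ f ⟧ℕ = ⟦ e ⟧ℕ + ⟦ f ⟧ℕ
  ⟦ e ⊗ f ⟧ℕ = ⟦ e ⟧ℕ * ⟦ f ⟧ℕ

  ⟦_⟧ℤ : Expr → ℤ
  ⟦ ‵ n ⟧ℤ   = + n
  ⟦ e ⊕ f ⟧ℤ = ⟦ e ⟧ℤ +ℤ ⟦ f ⟧ℤ
  ⟦ e ⊗ f ⟧ℤ = ⟦ e ⟧ℤ *ℤ ⟦ f ⟧ℤ

  cast : ∀ e → + ⟦ e ⟧ℕ ≡ ⟦ e ⟧ℤ
  cast (‵ n)   = refl
  cast (e ⊕ f) = cong₂ _+ℤ_ (cast e) (cast f)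
  cast (e ⊗ f) = trans (pos-* ⟦ e ⟧ℕ ⟦ f ⟧ℕ) (cong₂ _*ℤ_ (cast e) (cast f))

  ≤-transpose : ∀ {x y z n} → x + y + z ≤ n → + x ≤ℤ + n - + y - + z
  ≤-transpose {x} {y} {z} {n} le = subst (_≤ℤ + n - + y - + z) (cancel (+ x) (+ y) (+ z))
    (+-monoˡ-≤ (- + z) (+-monoˡ-≤ (- + y) (+≤+ le)))
    where
    cancel : ∀ x y z → x +ℤ y +ℤ z - y - z ≡ x
    cancel = ℤ-Solver.solve-∀

  ≡-transpose : ∀ {x y z n} → + x ≡ + n - + y - + z → x + y + z ≡ n
  ≡-transpose {x} {y} {z} {n} eq = +-injective (trans (cong (λ w → w +ℤ + y +ℤ + z) eq) (cancel (+ n) (+ y) (+ z)))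
    where
    cancel : ∀ n y z → n - y - z +ℤ y +ℤ z ≡ n
    cancel = ℤ-Solver.solve-∀

  cast-∸ : ∀ {m n} → n ≤ m → + (m ∸ n) ≡ + m - + n
  cast-∸ {m} {n} n≤m = sym (trans (m-n≡m⊖n m n) (⊖-≥ n≤m))

module Blocks (a b : ℕ) .{{_ : NonZero a}} .{{_ : NonZero b}} (coprime : Coprime a b) (k : ℕ) where
  open Residues a b coprime
  open Representations a b coprime
  open ListFacts
  open import Data.Nat.Properties
  open import Data.Nat.DivMod
  open import Data.List.Membership.Propositional.Properties
    using (∈-upTo⁺; ∈-upTo⁻; ∈-map⁺; ∈-map⁻; ∈-concatMap⁺; ∈-concatMap⁻)
  open import Data.List.Membership.Propositional using (lose)
  open import Data.List.Properties using (map-upTo)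

  -- Block m consists of the numbers ≡ m·a (mod b) below (m + k·b)·a: the
  -- progression first m, first m + b, … with count m terms.  T is the
  -- concatenation of the blocks m = 0, …, b - 1.
  first : ℕ → ℕ
  first m = (m * a) % b

  count : ℕ → ℕ
  count m = (m * a) / b + k * a

  block : ℕ → List ℕ
  block m = map (λ i → first m + i * b) (upTo (count m))

  T : List ℕ
  T = concatMap block (upTo b)

  block-end : ∀ m → first m + count m * b ≡ (m + k * b) * a
  block-end m = begin
    first m + ((m * a) / b + k * a) * b        ≡⟨ cong (λ n → first m + n) (*-distribʳ-+ b ((m * a) / b) (k * a)) ⟩
    first m + ((m * a) / b * b + k * a * b)    ≡⟨ sym (+-assoc (first m) _ _) ⟩
    first m + (m * a) / b * b + k * a * b      ≡⟨ cong (_+ k * a * b) (sym (m≡m%n+[m/n]*n (m * a) b)) ⟩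
    m * a + k * a * b                          ≡⟨ sym (multiplier-shift m k) ⟩
    (m + k * b) * a                            ∎
    where open ≡-Reasoning

  ∈-block⁻ : ∀ m {x} → x ∈ block m → Σ ℕ λ i → i < count m × x ≡ first m + i * b
  ∈-block⁻ m x∈ with ∈-map⁻ (λ i → first m + i * b) {xs = upTo (count m)} x∈
  ... | i , i∈ , refl = i , ∈-upTo⁻ i∈ , refl

  block-residue : ∀ m {x} → x ∈ block m → x % b ≡ (m * a) % b
  block-residue m x∈ with ∈-block⁻ m x∈
  ... | i , _ , refl = trans ([m+kn]%n≡m%n (first m) i b) (m%n%n≡m%n (m * a) b)

  T-unique : Unique T
  T-unique = concatMap-unique block (Unique.upTo⁺ b) block-unique disjoint
    where
    block-unique : ∀ m → Unique (block m)
    block-unique m = Unique.map⁺ (λ e → *-cancelʳ-≡ _ _ b (+-cancelˡ-≡ (first m) _ _ e)) (Unique.upTo⁺ (count m))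
    disjoint : ∀ {m m' x} → m ∈ upTo b → m' ∈ upTo b → x ∈ block m → x ∈ block m' → m ≡ m'
    disjoint {m} {m'} m∈ m'∈ x∈ x∈' = multiples-injective (∈-upTo⁻ m∈) (∈-upTo⁻ m'∈)
      (trans (sym (block-residue m x∈)) (block-residue m' x∈'))

  -- T consists of the x lying below (μ x + k·b)·a: x lies in block μ x.
  ∈T⇒below : ∀ {x} → x ∈ T → x < (μ x + k * b) * a
  ∈T⇒below {x} x∈ with find (∈-concatMap⁻ block {xs = upTo b} x∈)
  ... | m , m∈ , x∈block with ∈-block⁻ m x∈block
  ... | i , i<count , refl = subst (λ z → first m + i * b < (z + k * b) * a) μ≡ (begin-strict
    first m + i * b      <⟨ +-monoʳ-< (first m) (*-monoˡ-< b i<count) ⟩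
    first m + count m * b ≡⟨ block-end m ⟩
    (m + k * b) * a      ∎)
    where
    open ≤-Reasoning
    μ≡ : m ≡ μ (first m + i * b)
    μ≡ = μ-unique (∈-upTo⁻ m∈) (sym (block-residue m x∈block))

  below⇒∈T : ∀ {x} → x < (μ x + k * b) * a → x ∈ T
  below⇒∈T {x} below = ∈-concatMap⁺ block (lose (∈-upTo⁺ (μ<b x)) x∈block)
    where
    m = μ x
    i = x / b
    x≡ : x ≡ first m + i * b
    x≡ = trans (m≡m%n+[m/n]*n x b) (cong (_+ i * b) (sym (μ-residue x)))
    i<count : i < count m
    i<count = *-cancelʳ-< b i (count m) (+-cancelˡ-< (first m) _ _
      (subst₂ _<_ x≡ (sym (block-end m)) below))
    x∈block : x ∈ block m
    x∈block = subst (_∈ block m) (sym x≡) (∈-map⁺ (λ i → first m + i * b) (∈-upTo⁺ i<count))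

  T-members : ∀ x → (x ∈ T) ⇔ (numReps a b x ≤ k)
  T-members x = mk⇔ (λ x∈ → Equivalence.from (numReps≤⇔ x k) (∈T⇒below x∈))
                    (λ few → below⇒∈T (Equivalence.to (numReps≤⇔ x k) few))

  firsts-↭ : map first (upTo b) ↭ upTo b
  firsts-↭ = same-members⇒↭ firsts-unique (Unique.upTo⁺ b) to from
    where
    firsts-unique : Unique (map first (upTo b))
    firsts-unique = subst Unique (sym (map-upTo first b))
      (Unique.applyUpTo⁺₁ first b (λ i<j j<b e → <⇒≢ i<j (multiples-injective (<-trans i<j j<b) j<b e)))
    to : ∀ {x} → x ∈ map first (upTo b) → x ∈ upTo b
    to x∈ with ∈-map⁻ first {xs = upTo b} x∈
    ... | m , _ , refl = ∈-upTo⁺ (m%n<n (m * a) b)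
    from : ∀ {x} → x ∈ upTo b → x ∈ map first (upTo b)
    from {x} x∈ = subst (_∈ map first (upTo b)) (trans (μ-residue x) (m<n⇒m%n≡m (∈-upTo⁻ x∈)))
      (∈-map⁺ first (∈-upTo⁺ (μ<b x)))

module BlockSums (a b : ℕ) .{{_ : NonZero a}} .{{_ : NonZero b}} (coprime : Coprime a b) (k : ℕ) where
  open Blocks a b coprime k
  open ListFacts using (length-concatMap; sum-concatMap)
  open IntegerSums
  open Casts
  open import Data.Integer.Properties using (pos-*; *-cancelˡ-≡; +-injective)
  import Data.Integer.Tactic.RingSolver as ℤ-Solver
  import Data.Nat.Properties as ℕ
  open import Data.List.Properties using (map-∘; length-map; length-upTo)

  A B K : ℤ
  A = + a
  B = + b
  K = + k

  U : ℕ → ℤ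
  U m = (+ m +ℤ K *ℤ B) *ℤ A

  block-end-ℤ : ∀ m → + first m +ℤ + count m *ℤ B ≡ U m
  block-end-ℤ m = begin
    + first m +ℤ + count m *ℤ B ≡⟨ sym (cast (‵ first m ⊕ ‵ count m ⊗ ‵ b)) ⟩
    + (first m + count m * b)   ≡⟨ cong +_ (block-end m) ⟩
    + ((m + k * b) * a)         ≡⟨ cast ((‵ m ⊕ ‵ k ⊗ ‵ b) ⊗ ‵ a) ⟩
    U m                         ∎
    where open ≡-Reasoning

  -- Summing G (end point) - G (first element) over the blocks; the first
  -- elements run through 0, …, b - 1.
  ∑-blocks : ∀ (G : ℤ → ℤ) → ∑ (upTo b) (λ m → G (U m) - G (+ first m))
                            ≡ ∑ (upTo b) (λ m → G (U m)) - ∑ (upTo b) (λ i → G (+ i))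
  ∑-blocks G = trans (∑-- (upTo b) (λ m → G (U m)) (λ m → G (+ first m)))
    (cong (∑ (upTo b) (λ m → G (U m)) -_) (trans (cong (foldr _+ℤ_ 0ℤ) (map-∘ (upTo b))) (∑-↭ (λ i → G (+ i)) firsts-↭)))

  block-length : ∀ m → B *ℤ + length (block m) ≡ U m - + first m
  block-length m = begin
    B *ℤ + length (block m)                   ≡⟨ cong (λ n → B *ℤ + n) block-size ⟩
    B *ℤ + count m                            ≡⟨ isolate (+ first m) (+ count m) B ⟩
    (+ first m +ℤ + count m *ℤ B) - + first m ≡⟨ cong (_- + first m) (block-end-ℤ m) ⟩
    U m - + first m                           ∎
    where
    open ≡-Reasoning
    block-size : length (block m) ≡ count m
    block-size = trans (length-map _ (upTo (count m))) (length-upTo (count m))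
    isolate : ∀ r c d → d *ℤ c ≡ (r +ℤ c *ℤ d) - r
    isolate = ℤ-Solver.solve-∀

  block-sum : ∀ m → + 2 *ℤ B *ℤ + sum (block m) ≡ Φ B (U m) - Φ B (+ first m)
  block-sum m = begin
    + 2 *ℤ B *ℤ + sum (block m)
      ≡⟨ cong (+ 2 *ℤ B *ℤ_) (trans (sum-cast (upTo (count m)) (λ i → first m + i * b))
                                     (∑-cong (upTo (count m)) (λ i → cast (‵ first m ⊕ ‵ i ⊗ ‵ b)))) ⟩
    + 2 *ℤ B *ℤ ∑ (upTo (count m)) (λ i → + first m +ℤ + i *ℤ B)
      ≡⟨ ∑-progression (count m) (+ first m) B ⟩
    Φ B (+ first m +ℤ + count m *ℤ B) - Φ B (+ first m)
      ≡⟨ cong (λ u → Φ B u - Φ B (+ first m)) (block-end-ℤ m) ⟩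
    Φ B (U m) - Φ B (+ first m) ∎
    where open ≡-Reasoning

  length-T-ℤ : B *ℤ + length T ≡ ∑ (upTo b) U - ∑ (upTo b) (λ i → + i)
  length-T-ℤ = begin
    B *ℤ + length T
      ≡⟨ cong (B *ℤ_) (trans (cong +_ (length-concatMap block (upTo b))) (sum-cast (upTo b) (λ m → length (block m)))) ⟩
    B *ℤ ∑ (upTo b) (λ m → + length (block m))
      ≡⟨ sym (∑-*ˡ (upTo b) B (λ m → + length (block m))) ⟩
    ∑ (upTo b) (λ m → B *ℤ + length (block m))
      ≡⟨ ∑-cong (upTo b) block-length ⟩
    ∑ (upTo b) (λ m → U m - + first m)
      ≡⟨ ∑-blocks (λ x → x) ⟩
    ∑ (upTo b) U - ∑ (upTo b) (λ i → + i) ∎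
    where open ≡-Reasoning

  sum-T-ℤ : + 2 *ℤ B *ℤ + sum T ≡ ∑ (upTo b) (λ m → Φ B (U m)) - ∑ (upTo b) (λ i → Φ B (+ i))
  sum-T-ℤ = begin
    + 2 *ℤ B *ℤ + sum T
      ≡⟨ cong (+ 2 *ℤ B *ℤ_) (trans (cong +_ (sum-concatMap block (upTo b))) (sum-cast (upTo b) (λ m → sum (block m)))) ⟩
    + 2 *ℤ B *ℤ ∑ (upTo b) (λ m → + sum (block m))
      ≡⟨ sym (∑-*ˡ (upTo b) (+ 2 *ℤ B) (λ m → + sum (block m))) ⟩
    ∑ (upTo b) (λ m → + 2 *ℤ B *ℤ + sum (block m))
      ≡⟨ ∑-cong (upTo b) block-sum ⟩
    ∑ (upTo b) (λ m → Φ B (U m) - Φ B (+ first m))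
      ≡⟨ ∑-blocks (Φ B) ⟩
    ∑ (upTo b) (λ m → Φ B (U m)) - ∑ (upTo b) (λ i → Φ B (+ i)) ∎
    where open ≡-Reasoning

  two-∑U : + 2 *ℤ ∑ (upTo b) U ≡ A *ℤ (B *ℤ B - B) +ℤ + 2 *ℤ (K *ℤ B *ℤ A) *ℤ B
  two-∑U = trans (cong (+ 2 *ℤ_) (∑-cong (upTo b) (λ m → linear (+ m) K B A))) (∑-linear b A (K *ℤ B *ℤ A))
    where
    linear : ∀ M K B A → (M +ℤ K *ℤ B) *ℤ A ≡ A *ℤ M +ℤ K *ℤ B *ℤ A
    linear = ℤ-Solver.solve-∀

  two-∑i : + 2 *ℤ ∑ (upTo b) (λ i → + i) ≡ + 1 *ℤ (B *ℤ B - B) +ℤ + 2 *ℤ 0ℤ *ℤ B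
  two-∑i = trans (cong (+ 2 *ℤ_) (∑-cong (upTo b) (λ i → linear (+ i)))) (∑-linear b (+ 1) 0ℤ)
    where
    linear : ∀ M → M ≡ + 1 *ℤ M +ℤ 0ℤ
    linear = ℤ-Solver.solve-∀

  six-∑ΦU : + 6 *ℤ ∑ (upTo b) (λ m → Φ B (U m))
    ≡ A *ℤ A *ℤ (+ 2 *ℤ B *ℤ B *ℤ B - + 3 *ℤ B *ℤ B +ℤ B)
      +ℤ + 3 *ℤ (+ 2 *ℤ A *ℤ (K *ℤ B *ℤ A) - A *ℤ B) *ℤ (B *ℤ B - B)
      +ℤ + 6 *ℤ (K *ℤ B *ℤ A *ℤ (K *ℤ B *ℤ A - B)) *ℤ B
  six-∑ΦU = trans (cong (+ 6 *ℤ_) (∑-cong (upTo b) (λ m → quadratic (+ m) K B A)))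
                  (∑-quadratic b (A *ℤ A) (+ 2 *ℤ A *ℤ (K *ℤ B *ℤ A) - A *ℤ B) (K *ℤ B *ℤ A *ℤ (K *ℤ B *ℤ A - B)))
    where
    quadratic : ∀ M K B A → ((M +ℤ K *ℤ B) *ℤ A) *ℤ ((M +ℤ K *ℤ B) *ℤ A - B)
      ≡ A *ℤ A *ℤ (M *ℤ M) +ℤ (+ 2 *ℤ A *ℤ (K *ℤ B *ℤ A) - A *ℤ B) *ℤ M +ℤ K *ℤ B *ℤ A *ℤ (K *ℤ B *ℤ A - B)
    quadratic = ℤ-Solver.solve-∀

  six-∑Φi : + 6 *ℤ ∑ (upTo b) (λ i → Φ B (+ i))
    ≡ + 1 *ℤ (+ 2 *ℤ B *ℤ B *ℤ B - + 3 *ℤ B *ℤ B +ℤ B) +ℤ + 3 *ℤ (0ℤ - B) *ℤ (B *ℤ B - B) +ℤ + 6 *ℤ 0ℤ *ℤ B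
  six-∑Φi = trans (cong (+ 6 *ℤ_) (∑-cong (upTo b) (λ i → quadratic (+ i) B))) (∑-quadratic b (+ 1) (0ℤ - B) 0ℤ)
    where
    quadratic : ∀ M B → M *ℤ (M - B) ≡ + 1 *ℤ (M *ℤ M) +ℤ (0ℤ - B) *ℤ M +ℤ 0ℤ
    quadratic = ℤ-Solver.solve-∀

  statement-length : + ((a ∸ 1) * (b ∸ 1) + 2 * a * b * k) ≡ (A - + 1) *ℤ (B - + 1) +ℤ + 2 *ℤ A *ℤ B *ℤ K
  statement-length = begin
    + ((a ∸ 1) * (b ∸ 1) + 2 * a * b * k)
      ≡⟨ cast (‵ (a ∸ 1) ⊗ ‵ (b ∸ 1) ⊕ ‵ 2 ⊗ ‵ a ⊗ ‵ b ⊗ ‵ k) ⟩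
    + (a ∸ 1) *ℤ + (b ∸ 1) +ℤ + 2 *ℤ A *ℤ B *ℤ K
      ≡⟨ cong₂ (λ x y → x *ℤ y +ℤ + 2 *ℤ A *ℤ B *ℤ K) (cast-∸ (>-nonZero⁻¹ a)) (cast-∸ (>-nonZero⁻¹ b)) ⟩
    (A - + 1) *ℤ (B - + 1) +ℤ + 2 *ℤ A *ℤ B *ℤ K ∎
    where open ≡-Reasoning

  -- The shape of the statement's formula for 12·(sum of T), so that its
  -- natural-number atoms can be cast to ℤ one at a time.
  sum-shape : ℤ → ℤ → ℤ → ℤ → ℤ → ℤ → ℤ
  sum-shape x₁ x₂ x₃ x₄ x₅ x₆ = x₁ +ℤ + 6 *ℤ (x₂ - A - B) *ℤ x₃ +ℤ x₄ - x₅ +ℤ (x₆ - + 1)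

  sum-shape-cong : ∀ {x₁ x₂ x₃ x₄ x₅ x₆ y₁ y₂ y₃ y₄ y₅ y₆} →
    x₁ ≡ y₁ → x₂ ≡ y₂ → x₃ ≡ y₃ → x₄ ≡ y₄ → x₅ ≡ y₅ → x₆ ≡ y₆ →
    sum-shape x₁ x₂ x₃ x₄ x₅ x₆ ≡ sum-shape y₁ y₂ y₃ y₄ y₅ y₆
  sum-shape-cong refl refl refl refl refl refl = refl

  statement-sum :
    + (6 * a * a * b * b * k * k) +ℤ + 6 *ℤ (+ (a * b) - + a - + b) *ℤ + (a * b * k)
      +ℤ + (2 * a * a * b * b) - + (3 * (a + b ∸ 1) * a * b) +ℤ (+ (a * a + b * b) - + 1)
    ≡ sum-shape (+ 6 *ℤ A *ℤ A *ℤ B *ℤ B *ℤ K *ℤ K) (A *ℤ B) (A *ℤ B *ℤ K)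
                (+ 2 *ℤ A *ℤ A *ℤ B *ℤ B) (+ 3 *ℤ (A +ℤ B - + 1) *ℤ A *ℤ B) (A *ℤ A +ℤ B *ℤ B)
  statement-sum = sum-shape-cong
    (cast (‵ 6 ⊗ ‵ a ⊗ ‵ a ⊗ ‵ b ⊗ ‵ b ⊗ ‵ k ⊗ ‵ k))
    (cast (‵ a ⊗ ‵ b))
    (cast (‵ a ⊗ ‵ b ⊗ ‵ k))
    (cast (‵ 2 ⊗ ‵ a ⊗ ‵ a ⊗ ‵ b ⊗ ‵ b))
    (trans (cast (‵ 3 ⊗ ‵ (a + b ∸ 1) ⊗ ‵ a ⊗ ‵ b))
           (cong (λ x → + 3 *ℤ x *ℤ A *ℤ B) (cast-∸ (ℕ.≤-trans (>-nonZero⁻¹ a) (ℕ.m≤m+n a b)))))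
    (cast (‵ a ⊗ ‵ a ⊕ ‵ b ⊗ ‵ b))

  length-T : 2 * length T ≡ (a ∸ 1) * (b ∸ 1) + 2 * a * b * k
  length-T = +-injective (*-cancelˡ-≡ B _ _ (begin
    B *ℤ + (2 * length T)                               ≡⟨ cong (B *ℤ_) (pos-* 2 (length T)) ⟩
    B *ℤ (+ 2 *ℤ + length T)                            ≡⟨ reorder B (+ length T) ⟩
    + 2 *ℤ (B *ℤ + length T)                            ≡⟨ cong (+ 2 *ℤ_) length-T-ℤ ⟩
    + 2 *ℤ (∑ (upTo b) U - ∑ (upTo b) (λ i → + i))      ≡⟨ distrib (+ 2) (∑ (upTo b) U) (∑ (upTo b) (λ i → + i)) ⟩
    + 2 *ℤ ∑ (upTo b) U - + 2 *ℤ ∑ (upTo b) (λ i → + i) ≡⟨ cong₂ _-_ two-∑U two-∑i ⟩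
    A *ℤ (B *ℤ B - B) +ℤ + 2 *ℤ (K *ℤ B *ℤ A) *ℤ B - (+ 1 *ℤ (B *ℤ B - B) +ℤ + 2 *ℤ 0ℤ *ℤ B)
                                                        ≡⟨ algebra A B K ⟩
    B *ℤ ((A - + 1) *ℤ (B - + 1) +ℤ + 2 *ℤ A *ℤ B *ℤ K) ≡⟨ cong (B *ℤ_) (sym statement-length) ⟩
    B *ℤ + ((a ∸ 1) * (b ∸ 1) + 2 * a * b * k)          ∎))
    where
    open ≡-Reasoning
    reorder : ∀ x y → x *ℤ (+ 2 *ℤ y) ≡ + 2 *ℤ (x *ℤ y)
    reorder = ℤ-Solver.solve-∀
    distrib : ∀ c x y → c *ℤ (x - y) ≡ c *ℤ x - c *ℤ y
    distrib = ℤ-Solver.solve-∀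
    algebra : ∀ A B K → A *ℤ (B *ℤ B - B) +ℤ + 2 *ℤ (K *ℤ B *ℤ A) *ℤ B - (+ 1 *ℤ (B *ℤ B - B) +ℤ + 2 *ℤ 0ℤ *ℤ B)
                      ≡ B *ℤ ((A - + 1) *ℤ (B - + 1) +ℤ + 2 *ℤ A *ℤ B *ℤ K)
    algebra = ℤ-Solver.solve-∀

  sum-T : + (12 * sum T) ≡
    + (6 * a * a * b * b * k * k) +ℤ + 6 *ℤ (+ (a * b) - + a - + b) *ℤ + (a * b * k)
      +ℤ + (2 * a * a * b * b) - + (3 * (a + b ∸ 1) * a * b) +ℤ (+ (a * a + b * b) - + 1)
  sum-T = *-cancelˡ-≡ B _ _ (begin
    B *ℤ + (12 * sum T)                                   ≡⟨ cong (B *ℤ_) (pos-* 12 (sum T)) ⟩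
    B *ℤ (+ 12 *ℤ + sum T)                                ≡⟨ reorder B (+ sum T) ⟩
    + 6 *ℤ (+ 2 *ℤ B *ℤ + sum T)                          ≡⟨ cong (+ 6 *ℤ_) sum-T-ℤ ⟩
    + 6 *ℤ (∑ (upTo b) ΦU - ∑ (upTo b) Φi)                ≡⟨ distrib (+ 6) (∑ (upTo b) ΦU) (∑ (upTo b) Φi) ⟩
    + 6 *ℤ ∑ (upTo b) ΦU - + 6 *ℤ ∑ (upTo b) Φi           ≡⟨ cong₂ _-_ six-∑ΦU six-∑Φi ⟩
    A *ℤ A *ℤ (+ 2 *ℤ B *ℤ B *ℤ B - + 3 *ℤ B *ℤ B +ℤ B)
      +ℤ + 3 *ℤ (+ 2 *ℤ A *ℤ (K *ℤ B *ℤ A) - A *ℤ B) *ℤ (B *ℤ B - B)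
      +ℤ + 6 *ℤ (K *ℤ B *ℤ A *ℤ (K *ℤ B *ℤ A - B)) *ℤ B
    - (+ 1 *ℤ (+ 2 *ℤ B *ℤ B *ℤ B - + 3 *ℤ B *ℤ B +ℤ B) +ℤ + 3 *ℤ (0ℤ - B) *ℤ (B *ℤ B - B) +ℤ + 6 *ℤ 0ℤ *ℤ B)
                                                          ≡⟨ algebra A B K ⟩
    B *ℤ sum-shape (+ 6 *ℤ A *ℤ A *ℤ B *ℤ B *ℤ K *ℤ K) (A *ℤ B) (A *ℤ B *ℤ K)
                   (+ 2 *ℤ A *ℤ A *ℤ B *ℤ B) (+ 3 *ℤ (A +ℤ B - + 1) *ℤ A *ℤ B) (A *ℤ A +ℤ B *ℤ B)
                                                          ≡⟨ cong (B *ℤ_) (sym statement-sum) ⟩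
    B *ℤ (+ (6 * a * a * b * b * k * k) +ℤ + 6 *ℤ (+ (a * b) - + a - + b) *ℤ + (a * b * k)
      +ℤ + (2 * a * a * b * b) - + (3 * (a + b ∸ 1) * a * b) +ℤ (+ (a * a + b * b) - + 1)) ∎)
    where
    open ≡-Reasoning
    ΦU Φi : ℕ → ℤ
    ΦU m = Φ B (U m)
    Φi i = Φ B (+ i)
    reorder : ∀ x y → x *ℤ (+ 12 *ℤ y) ≡ + 6 *ℤ (+ 2 *ℤ x *ℤ y)
    reorder = ℤ-Solver.solve-∀
    distrib : ∀ c x y → c *ℤ (x - y) ≡ c *ℤ x - c *ℤ y
    distrib = ℤ-Solver.solve-∀
    algebra : ∀ A B K →
      A *ℤ A *ℤ (+ 2 *ℤ B *ℤ B *ℤ B - + 3 *ℤ B *ℤ B +ℤ B)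
        +ℤ + 3 *ℤ (+ 2 *ℤ A *ℤ (K *ℤ B *ℤ A) - A *ℤ B) *ℤ (B *ℤ B - B)
        +ℤ + 6 *ℤ (K *ℤ B *ℤ A *ℤ (K *ℤ B *ℤ A - B)) *ℤ B
      - (+ 1 *ℤ (+ 2 *ℤ B *ℤ B *ℤ B - + 3 *ℤ B *ℤ B +ℤ B) +ℤ + 3 *ℤ (0ℤ - B) *ℤ (B *ℤ B - B) +ℤ + 6 *ℤ 0ℤ *ℤ B)
      ≡ B *ℤ (+ 6 *ℤ A *ℤ A *ℤ B *ℤ B *ℤ K *ℤ K +ℤ + 6 *ℤ (A *ℤ B - A - B) *ℤ (A *ℤ B *ℤ K)
              +ℤ + 2 *ℤ A *ℤ A *ℤ B *ℤ B - + 3 *ℤ (A +ℤ B - + 1) *ℤ A *ℤ B +ℤ (A *ℤ A +ℤ B *ℤ B - + 1))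
    algebra = ℤ-Solver.solve-∀

-- Matching a and b against suc provides the NonZero instances;
-- the Frobenius bound and its attainment are transposed from ℕ to ℤ, and T
-- is the block list with its membership, length and sum formulas.
corollary5 : (a b k : ℕ) → 0 < a → 0 < b → Coprime a b →
    ((∀ (j : ℕ) → numReps a b j ≤ k → + j ≤ℤ (+ ((k + 1) * a * b) - + a - + b))
      × (∀ (g : ℕ) → + g ≡ + ((k + 1) * a * b) - + a - + b → numReps a b g ≤ k))
    × Σ (List ℕ) (λ T → Unique T × (∀ (j : ℕ) → (j ∈ T) ⇔ (numReps a b j ≤ k))
        × (2 * length T ≡ (a ∸ 1) * (b ∸ 1) + 2 * a * b * k)
        × (+ (12 * sum T) ≡
            + (6 * a * a * b * b * k * k)
            +ℤ + 6 *ℤ (+ (a * b) - + a - + b) *ℤ + (a * b * k)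
            +ℤ + (2 * a * a * b * b)
            - + (3 * (a + b ∸ 1) * a * b)
            +ℤ (+ (a * a + b * b) - + 1)))
corollary5 a@(suc _) b@(suc _) k _ _ coprime =
  ( (λ j few → ≤-transpose (few-representations⇒bounded j k few))
  , (λ g eq → bound-attained g k (≡-transpose eq)) )
  , T , T-unique , T-members , length-T , sum-T
  where
  open Casts using (≤-transpose; ≡-transpose)
  open Representations a b coprime using (few-representations⇒bounded; bound-attained)
  open Blocks a b coprime k using (T; T-unique; T-members)
  open BlockSums a b coprime k using (length-T; sum-T)
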